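{- Let $x=(x_n)_{n\ge0}$ be an infinite binary word and let $y=(y_n)_{n\geq0}=\Delta(x)$. If $x$ contains a repetition $(x_ix_{i+1}\cdots x_{i+\ell-1})^e\,x_ix_{i+1}\cdots x_{i+t-1}$ (occurring at position $i$) for some positive integers $e\ge2$, $\ell\ge1$ and $t\le\ell$, then $y$ contains the repetition $(y_iy_{i+1}\cdots y_{i+\ell-1})^e\,y_iy_{i+1}\cdots y_{i+t-2}$, and the number of $1$'s in $y_iy_{i+1}\cdots y_{i+\ell-1}$ is even.
   Context: For an infinite binary word $x=(x_n)_{n\ge0}$, $\Delta(x)=((x_n+x_{n+1})\bmod 2)_{n\ge0}$ is its sequence of first differences modulo $2$. -}

module Defs where

open import Data.Bool using (Bool; true; false; _xor_)
open import Data.Nat using (ℕ; zero; suc; _+_; _*_; _∸_; _<_; NonZero)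
open import Data.Nat.DivMod using (_%_)
open import Relation.Binary.PropositionalEquality using (_≡_)

Word : Set
Word = ℕ → Bool

Δ : Word → Word
Δ x n = x n xor x (suc n)

-- x contains, at position i, the repetition (x_i … x_{i+ℓ-1})^e x_i … x_{i+m-1}
-- i.e. the factor of length e*ℓ + m starting at i equals the prefix of the
-- periodic word (x_i … x_{i+ℓ-1})^ω of that length.
RepetitionAt : Word → (i ℓ : ℕ) → .{{NonZero ℓ}} → (e m : ℕ) → Set
RepetitionAt x i ℓ e m = ∀ k → k < e * ℓ + m → x (i + k) ≡ x (i + k % ℓ)

bitToℕ : Bool → ℕ
bitToℕ false = 0
bitToℕ true  = 1

countOnes : Word → (i ℓ : ℕ) → ℕ
countOnes w i zero    = 0
countOnes w i (suc ℓ) = bitToℕ (w i) + countOnes w (suc i) ℓ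

{-# OPTIONS --safe #-}
-- A repetition of period L = ℓ + 1 and length at least L + 1 gives x (i + L) ≡ x i.
-- Since Δ x (i + k) only involves x (i + k) and x (i + k + 1), the repetition
-- passes to Δ x with one letter less, the wrap-around at the end of each period
-- being exactly x (i + L) ≡ x i. Modulo 2 the number of 1's in
-- Δ x (i) … Δ x (i + L - 1) telescopes to x i ⊕ x (i + L) = 0.
module Submission where

open import Defs
open import Data.Bool using (true; false; _xor_)
open import Data.Bool.Properties using (xor-same)
open import Data.Nat using (ℕ; zero; suc; _+_; _*_; _∸_; _≤_; _<_; z≤n; s≤s; NonZero)
open import Data.Nat.Properties
open import Data.Nat.DivMod
open import Data.Nat.Divisibility using (_∣_; m%n≡0⇒n∣m)
open import Data.Product using (_×_; _,_)
open import Data.Sum using (inj₁; inj₂)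
open import Relation.Binary.PropositionalEquality

bitToℕ-xor-telescope : ∀ a b c → (bitToℕ (a xor b) + bitToℕ (b xor c)) % 2 ≡ bitToℕ (a xor c)
bitToℕ-xor-telescope false false false = refl
bitToℕ-xor-telescope false false true  = refl
bitToℕ-xor-telescope false true  false = refl
bitToℕ-xor-telescope false true  true  = refl
bitToℕ-xor-telescope true  false false = refl
bitToℕ-xor-telescope true  false true  = refl
bitToℕ-xor-telescope true  true  false = refl
bitToℕ-xor-telescope true  true  true  = refl

bitToℕ<2 : ∀ b → bitToℕ b < 2
bitToℕ<2 false = s≤s z≤n
bitToℕ<2 true  = s≤s (s≤s z≤n)

countOnes-Δ-mod2 : (x : Word) (i n : ℕ) → countOnes (Δ x) i n % 2 ≡ bitToℕ (x i xor x (i + n))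
countOnes-Δ-mod2 x i zero rewrite +-identityʳ i | xor-same (x i) = refl
countOnes-Δ-mod2 x i (suc n) = begin
  (bitToℕ (Δ x i) + countOnes (Δ x) (suc i) n) % 2
    ≡⟨ %-distribˡ-+ (bitToℕ (Δ x i)) _ 2 ⟩
  (bitToℕ (Δ x i) % 2 + countOnes (Δ x) (suc i) n % 2) % 2
    ≡⟨ cong₂ (λ a b → (a + b) % 2) (m<n⇒m%n≡m (bitToℕ<2 (Δ x i))) (countOnes-Δ-mod2 x (suc i) n) ⟩
  (bitToℕ (x i xor x (suc i)) + bitToℕ (x (suc i) xor x (suc i + n))) % 2
    ≡⟨ bitToℕ-xor-telescope (x i) (x (suc i)) (x (suc i + n)) ⟩
  bitToℕ (x i xor x (suc i + n))
    ≡⟨ cong (λ m → bitToℕ (x i xor x m)) (sym (+-suc i n)) ⟩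
  bitToℕ (x i xor x (i + suc n)) ∎
  where open ≡-Reasoning

module _ {L : ℕ} .{{_ : NonZero L}} (x : Word) (i : ℕ) where

  repetition-closes : ∀ {e m} → RepetitionAt x i L e m → L < e * L + m → x (i + L) ≡ x i
  repetition-closes rep L<len = begin
    x (i + L)      ≡⟨ rep L L<len ⟩
    x (i + L % L)  ≡⟨ cong (λ r → x (i + r)) (n%n≡0 L) ⟩
    x (i + 0)      ≡⟨ cong x (+-identityʳ i) ⟩
    x i            ∎
    where open ≡-Reasoning

  module _ (closes : x (i + L) ≡ x i) where

    shift-mod-period : ∀ r → r ≤ L → x (i + r % L) ≡ x (i + r)
    shift-mod-period r r≤L with m≤n⇒m<n∨m≡n r≤L
    ... | inj₁ r<L = cong (λ s → x (i + s)) (m<n⇒m%n≡m r<L)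
    ... | inj₂ refl = trans (cong (λ s → x (i + s)) (n%n≡0 L))
                            (trans (cong x (+-identityʳ i)) (sym closes))

    shift-suc-mod-period : ∀ k → x (i + suc k % L) ≡ x (suc (i + k % L))
    shift-suc-mod-period k = begin
      x (i + suc k % L)
        ≡⟨ cong (λ s → x (i + s % L)) (cong suc (m≡m%n+[m/n]*n k L)) ⟩
      x (i + (suc (k % L) + k / L * L) % L)
        ≡⟨ cong (λ s → x (i + s)) ([m+kn]%n≡m%n (suc (k % L)) (k / L) L) ⟩
      x (i + suc (k % L) % L)
        ≡⟨ shift-mod-period (suc (k % L)) (m%n<n k L) ⟩
      x (i + suc (k % L))
        ≡⟨ cong x (+-suc i (k % L)) ⟩
      x (suc (i + k % L)) ∎
      where open ≡-Reasoning

    Δ-repetition : ∀ {e m} → RepetitionAt x i L e (suc m) → RepetitionAt (Δ x) i L e m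
    Δ-repetition {e} {m} rep k k<len = cong₂ _xor_ (rep k (<-trans (n<1+n k) 1+k<len)) (begin
      x (suc (i + k))       ≡⟨ cong x (sym (+-suc i k)) ⟩
      x (i + suc k)         ≡⟨ rep (suc k) 1+k<len ⟩
      x (i + suc k % L)     ≡⟨ shift-suc-mod-period k ⟩
      x (suc (i + k % L))   ∎)
      where
      open ≡-Reasoning
      1+k<len : suc k < e * L + suc m
      1+k<len = subst (suc k <_) (sym (+-suc (e * L) m)) (s≤s k<len)

    countOnes-Δ-period-even : 2 ∣ countOnes (Δ x) i L
    countOnes-Δ-period-even = m%n≡0⇒n∣m _ 2 (begin
      countOnes (Δ x) i L % 2     ≡⟨ countOnes-Δ-mod2 x i L ⟩
      bitToℕ (x i xor x (i + L))  ≡⟨ cong (λ b → bitToℕ (x i xor b)) closes ⟩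
      bitToℕ (x i xor x i)        ≡⟨ cong bitToℕ (xor-same (x i)) ⟩
      0                           ∎)
      where open ≡-Reasoning

lemma16 : (x : Word) (i e ℓ t : ℕ) → 2 ≤ e → 1 ≤ t → t ≤ suc ℓ →
    RepetitionAt x i (suc ℓ) e t →
    RepetitionAt (Δ x) i (suc ℓ) e (t ∸ 1) × 2 ∣ countOnes (Δ x) i (suc ℓ)
lemma16 x i e ℓ (suc m) e≥2 _ _ rep =
  Δ-repetition x i closes {e} rep , countOnes-Δ-period-even x i closes
  where
  L<len : suc ℓ < e * suc ℓ + suc m
  L<len = <-≤-trans (subst (suc ℓ <_) (*-comm (suc ℓ) e) (m<m*n (suc ℓ) e e≥2))
                    (m≤m+n (e * suc ℓ) (suc m))
  closes : x (i + suc ℓ) ≡ x i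
  closes = repetition-closes x i {e} rep L<len
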